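{- Let $\Gamma$ be the incidence graph of a quasi-symmetric $(v,b,r,k,\lambda_1,0)$ SPBIBD $\mathcal D=(\mathcal P,\mathcal B,\mathcal I)$ of type $(k-1,t)$ with intersection numbers $x=0$ and $y=1$. The following are equivalent: (i) each point appears in exactly $2$ blocks; (ii) $\Gamma$ is isomorphic to the subdivision graph of a complete bipartite graph $K_{k,k}$ and $b=2k$. In this case, $\Gamma$ is $2$-$\mathcal B$-homogeneous.
   Context: An incidence structure $\mathcal D=(\mathcal P,\mathcal B,\mathcal I)$ has finite point set $\mathcal P$, block set $\mathcal B$, incidence $\mathcal I\subseteq\mathcal P\times\mathcal B$ (write $p\in B$). $(p,B)$ is a flag if $p\in B$, a non-flag otherwise. A $(v,b,r,k,\lambda_1,\lambda_2)$ SPBIBD of type $(s,t)$: $|\mathcal P|=v$, $|\mathcal B|=b$, each block has $k$ points, each point lies in $r$ blocks; any two distinct points lie together in exactly $\lambda_1$ or exactly $\lambda_2$ blocks; for every flag $(p,B)$ exactly $s$ points of $B$ other than $p$ lie together with $p$ in exactly $\lambda_1$ blocks; for every non-flag $(p,B)$ exactly $t$ points of $B$ lie together with $p$ in exactly $\lambda_1$ blocks. Standing assumptions: $v>k\ge2$, $r<b$. Quasi-symmetric with intersection numbers $x<y$: any two distinct blocks share exactly $x$ or $y$ points, and both values occur. The incidence graph is the bipartite graph on $\mathcal P\cup\mathcal B$ with $p\sim B$ iff $p\in B$. The subdivision graph of a graph $H$ replaces each edge $uw$ by a new vertex adjacent exactly to $u$ and $w$. In a graph, $\Gamma_i(u)$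 is the set of vertices at distance $i$ from $u$ and $\Gamma(u)=\Gamma_1(u)$. For a bipartite graph with color classes $Y,Y'$ in which every vertex of $Y$ has eccentricity $D\ge3$, it is $2$-$Y$-homogeneous if for every $1\le i\le D-1$ and all $x\in Y$, $y\in\Gamma_2(x)$, $z\in\Gamma_i(x)\cap\Gamma_i(y)$, the number $|\Gamma(x)\cap\Gamma(y)\cap\Gamma_{i-1}(z)|$ is independent of $x,y,z$. (Here $Y=\mathcal B$, whose vertices have eccentricity $4$.) -}

module Defs where

open import Data.Nat using (ℕ; zero; suc; _+_; _*_; _∸_; _≤_; _<_; _≡ᵇ_)
open import Data.Bool using (Bool; true; false; _∧_; not; if_then_else_)
open import Data.Fin using (Fin; zero; suc; _≟_)
open import Data.Sum using (_⊎_; inj₁; inj₂)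
open import Data.Product using (Σ; ∃; _×_; _,_)
open import Data.Empty using (⊥)
open import Data.Unit using (⊤)
open import Data.List using (List; length)
open import Data.List.Membership.Propositional using (_∈_)
open import Data.List.Relation.Unary.Unique.Propositional using (Unique)
open import Relation.Nullary using (¬_)
open import Relation.Nullary.Decidable using (⌊_⌋)
open import Relation.Binary.PropositionalEquality using (_≡_; _≢_)
open import Function.Bundles using (_⤖_; _⇔_; Bijection)

countF : ∀ {n} → (Fin n → Bool) → ℕ
countF {zero}  f = 0
countF {suc n} f = (if f zero then 1 else 0) + countF (λ i → f (suc i))

-- Incidence structures with point set Fin v, block set Fin b and
-- incidence relation I p B ≡ true  (p ∈ B).

Incidence : ℕ → ℕ → Set
Incidence v b = Fin v → Fin b → Bool

module _ {v b : ℕ} (I : Incidence v b) where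

  blockSize : Fin b → ℕ
  blockSize B = countF (λ p → I p B)

  pointDeg : Fin v → ℕ
  pointDeg p = countF (λ B → I p B)

  λpq : Fin v → Fin v → ℕ
  λpq p q = countF (λ B → I p B ∧ I q B)

  inter : Fin b → Fin b → ℕ
  inter B B' = countF (λ p → I p B ∧ I p B')

  -- (v,b,r,k,λ₁,λ₂) SPBIBD of type (s,t)  (v, b are the sizes of Fin v, Fin b)
  record IsSPBIBD (r k λ₁ λ₂ s t : ℕ) : Set where
    field
      block-size : ∀ B → blockSize B ≡ k
      replication : ∀ p → pointDeg p ≡ r
      two-lambdas : ∀ p q → p ≢ q → (λpq p q ≡ λ₁) ⊎ (λpq p q ≡ λ₂)
      flag-count : ∀ p B → I p B ≡ true →
        countF (λ q → not ⌊ q ≟ p ⌋ ∧ I q B ∧ (λpq p q ≡ᵇ λ₁)) ≡ s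
      nonflag-count : ∀ p B → I p B ≡ false →
        countF (λ q → I q B ∧ (λpq p q ≡ᵇ λ₁)) ≡ t

  record IsQuasiSymmetric (x y : ℕ) : Set where
    field
      two-intersections : ∀ B B' → B ≢ B' → (inter B B' ≡ x) ⊎ (inter B B' ≡ y)
      x-occurs : Σ (Fin b) λ B → Σ (Fin b) λ B' → B ≢ B' × inter B B' ≡ x
      y-occurs : Σ (Fin b) λ B → Σ (Fin b) λ B' → B ≢ B' × inter B B' ≡ y

record Graph : Set₁ where
  field
    V   : Set
    Adj : V → V → Set

open Graph public

IncAdj : ∀ {v b} → Incidence v b → Fin v ⊎ Fin b → Fin v ⊎ Fin b → Set
IncAdj I (inj₁ p) (inj₂ B) = I p B ≡ true
IncAdj I (inj₂ B) (inj₁ p) = I p B ≡ true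
IncAdj I (inj₁ _) (inj₁ _) = ⊥
IncAdj I (inj₂ _) (inj₂ _) = ⊥

IncidenceGraph : ∀ {v b} → Incidence v b → Graph
IncidenceGraph {v} {b} I = record { V = Fin v ⊎ Fin b ; Adj = IncAdj I }

IsBlock : ∀ {v b} → Fin v ⊎ Fin b → Set
IsBlock (inj₁ _) = ⊥
IsBlock (inj₂ _) = ⊤

record EdgeGraph : Set₁ where
  field
    Vtx  : Set
    Edge : Set
    end₁ : Edge → Vtx
    end₂ : Edge → Vtx

SubdivAdj : (H : EdgeGraph) → EdgeGraph.Vtx H ⊎ EdgeGraph.Edge H →
            EdgeGraph.Vtx H ⊎ EdgeGraph.Edge H → Set
SubdivAdj H (inj₁ u) (inj₂ e) = (EdgeGraph.end₁ H e ≡ u) ⊎ (EdgeGraph.end₂ H e ≡ u)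
SubdivAdj H (inj₂ e) (inj₁ u) = (EdgeGraph.end₁ H e ≡ u) ⊎ (EdgeGraph.end₂ H e ≡ u)
SubdivAdj H (inj₁ _) (inj₁ _) = ⊥
SubdivAdj H (inj₂ _) (inj₂ _) = ⊥

Subdivision : EdgeGraph → Graph
Subdivision H = record { V = EdgeGraph.Vtx H ⊎ EdgeGraph.Edge H ; Adj = SubdivAdj H }

CompleteBipartite : ℕ → ℕ → EdgeGraph
CompleteBipartite m n = record
  { Vtx = Fin m ⊎ Fin n ; Edge = Fin m × Fin n
  ; end₁ = λ { (i , j) → inj₁ i } ; end₂ = λ { (i , j) → inj₂ j } }

record _≅_ (G H : Graph) : Set where
  field
    bij : V G ⤖ V H
  f : V G → V H
  f = Bijection.to bij
  field
    preserves : ∀ a c → Adj G a c → Adj H (f a) (f c)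
    reflects  : ∀ a c → Adj H (f a) (f c) → Adj G a c

data Walk (G : Graph) : ℕ → V G → V G → Set where
  here : ∀ {x} → Walk G 0 x x
  step : ∀ {n x y z} → Adj G x y → Walk G n y z → Walk G (suc n) x z

-- Dist G x y n : the distance from x to y is exactly n  (y ∈ Γ_n(x))
Dist : (G : Graph) → V G → V G → ℕ → Set
Dist G x y n = Walk G n x y × (∀ m → m < n → ¬ Walk G m x y)

Eccentricity : (G : Graph) → V G → ℕ → Set
Eccentricity G x D =
  (∀ y → Σ ℕ λ m → m ≤ D × Dist G x y m) × Σ (V G) (λ y → Dist G x y D)

HasCard : {A : Set} → (A → Set) → ℕ → Set
HasCard {A} P c = Σ (List A) λ xs → Unique xs × (∀ w → (w ∈ xs) ⇔ P w) × length xs ≡ c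

TwoHomogeneous : (G : Graph) → (V G → Set) → Set
TwoHomogeneous G Y = Σ ℕ λ D → 3 ≤ D × (∀ x → Y x → Eccentricity G x D) ×
  (∀ i → 1 ≤ i → i ≤ D ∸ 1 → Σ ℕ λ c →
     ∀ x y z → Y x → Dist G x y 2 → Dist G x z i → Dist G y z i →
     HasCard (λ w → Adj G x w × Adj G y w × Dist G z w (i ∸ 1)) c)

-- Two blocks share at most one point and, when r = 2, every point lies on exactly two blocks, so
-- the points are the edges of a simple graph on the blocks.  As λ₂ = 0, two points are first
-- associates exactly when they are collinear, whence λ₁ = 1, and a disjoint pair of blocks forces
-- t = 1: a point off a block B lies on exactly one block meeting B.  This makes the block graph
-- complete bipartite, with parts the neighbours of a fixed block B₀ and the other blocks, each of
-- size k.  Hence b = 2k and Γ is the subdivision of K_{k,k}; seen from a block, the other blocks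
-- lie at distance 2 or 4 according to their part, which gives 2-homogeneity.  Conversely, a vertex
-- of the subdivided K_{k,k} has degree 2 or k, and a point of degree k would force blocks of size 2.

module Submission where

open import Defs
open import Data.Nat using (ℕ; zero; suc; _+_; _*_; _∸_; _≤_; _<_; z≤n; s≤s; _≡ᵇ_)
open import Data.Nat.Properties as ℕ using (≤-refl; ≤-antisym; ≤-reflexive; +-suc; +-identityʳ; ≰⇒>; ≡ᵇ⇒≡; ≡⇒≡ᵇ)
open import Data.Bool using (Bool; true; false; not; _∧_; _xor_; if_then_else_)
open import Data.Bool.Properties as Bool using (T-≡; ¬-not; not-injective; not-¬; xor-identityʳ; xor-comm; true-xor)
open import Data.Fin using (Fin; zero; suc; _≟_)
open import Data.Fin.Properties using (injective⇒≤; suc-injective; any?; 0≢1+n)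
open import Data.Product using (Σ; _×_; _,_; proj₁; proj₂)
open import Data.Sum as Sum using (_⊎_; inj₁; inj₂)
open import Data.Sum.Properties using (inj₁-injective; inj₂-injective)
open import Data.Empty using (⊥; ⊥-elim)
open import Function using (_∘_; Equivalence; mk↔ₛ′; mk⇔)
open import Function.Properties.Inverse using (↔⇒⤖)
open import Function.Bundles using (_⇔_; Bijection)
open import Relation.Nullary using (¬_; Dec; does; yes; no; ¬?; _×-dec_)
open import Relation.Binary.PropositionalEquality
open import Data.List using ([]; _∷_)
open import Data.List.Relation.Unary.Any using (here)
open import Data.List.Relation.Unary.AllPairs using ([]; _∷_)
open import Data.List.Relation.Unary.All using ([])

private
  countStep : Bool → ℕ → ℕ
  countStep b c = (if b then 1 else 0) + c

  unrankStep : ∀ b {c n} → (Fin c → Fin n) → Fin (countStep b c) → Fin (suc n)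
  unrankStep true  e zero    = zero
  unrankStep true  e (suc j) = suc (e j)
  unrankStep false e j       = suc (e j)

  rankStep : ∀ b {c} → Fin c → Fin (countStep b c)
  rankStep true  j = suc j
  rankStep false j = j

  rankHead : ∀ b {c} → b ≡ true → Fin (countStep b c)
  rankHead true _ = zero

unrank : ∀ {n} (f : Fin n → Bool) → Fin (countF f) → Fin n
unrank {suc n} f = unrankStep (f zero) (unrank (f ∘ suc))

rank : ∀ {n} (f : Fin n → Bool) i → f i ≡ true → Fin (countF f)
rank {suc n} f zero    t = rankHead (f zero) t
rank {suc n} f (suc i) t = rankStep (f zero) (rank (f ∘ suc) i t)

unrank-true : ∀ {n} (f : Fin n → Bool) j → f (unrank f j) ≡ true
unrank-true {suc n} f j with f zero in eq
unrank-true {suc n} f zero    | true = eq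
unrank-true {suc n} f (suc j) | true = unrank-true (f ∘ suc) j
unrank-true {suc n} f j       | false = unrank-true (f ∘ suc) j

unrank-injective : ∀ {n} (f : Fin n → Bool) {j j′} → unrank f j ≡ unrank f j′ → j ≡ j′
unrank-injective {suc n} f {j} {j′} e with f zero
unrank-injective {suc n} f {zero}  {zero}   e | true = refl
unrank-injective {suc n} f {suc j} {suc j′} e | true = cong suc (unrank-injective (f ∘ suc) (suc-injective e))
unrank-injective {suc n} f {j}     {j′}     e | false = unrank-injective (f ∘ suc) (suc-injective e)

unrank-rank : ∀ {n} (f : Fin n → Bool) i (t : f i ≡ true) → unrank f (rank f i t) ≡ i
unrank-rank {suc n} f zero t with f zero
unrank-rank {suc n} f zero refl | true = refl
unrank-rank {suc n} f (suc i) t with f zero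
... | true  = cong suc (unrank-rank (f ∘ suc) i t)
... | false = cong suc (unrank-rank (f ∘ suc) i t)

module Enumeration {n m : ℕ} (f : Fin n → Bool) (count≡m : countF f ≡ m) where
  opaque
    element : Fin m → Fin n
    element = unrank f ∘ subst Fin (sym count≡m)

    position : ∀ i → f i ≡ true → Fin m
    position i t = subst Fin count≡m (rank f i t)

    element-true : ∀ j → f (element j) ≡ true
    element-true j = unrank-true f _

    element-injective : ∀ {j j′} → element j ≡ element j′ → j ≡ j′
    element-injective e = subst-injective (sym count≡m) (unrank-injective f e)

    element-position : ∀ i t → element (position i t) ≡ i
    element-position i t = trans (cong (unrank f) (subst-sym-subst count≡m)) (unrank-rank f i t)

    position-cong : ∀ {i i′} t t′ → i ≡ i′ → position i t ≡ position i′ t′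
    position-cong t t′ e =
      element-injective (trans (element-position _ t) (trans e (sym (element-position _ t′))))

    position-element : ∀ j t → position (element j) t ≡ j
    position-element j t = element-injective (element-position (element j) t)

    position-injective : ∀ {i i′} t t′ → position i t ≡ position i′ t′ → i ≡ i′
    position-injective t t′ e =
      trans (sym (element-position _ t)) (trans (cong element e) (element-position _ t′))

private
  Fin-inhabited⇒1≤ : ∀ {m} → Fin m → 1 ≤ m
  Fin-inhabited⇒1≤ zero    = s≤s z≤n
  Fin-inhabited⇒1≤ (suc _) = s≤s z≤n

  Fin≤1-subsingleton : ∀ {m} → m ≤ 1 → (a c : Fin m) → a ≡ c
  Fin≤1-subsingleton (s≤s z≤n) zero zero = refl

  Fin2-one-of : ∀ {a c : Fin 2} d → a ≢ c → d ≡ a ⊎ d ≡ c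
  Fin2-one-of {zero}     {zero}     d          a≢c = ⊥-elim (a≢c refl)
  Fin2-one-of {suc zero} {suc zero} d          a≢c = ⊥-elim (a≢c refl)
  Fin2-one-of {zero}     {suc zero} zero       _   = inj₁ refl
  Fin2-one-of {zero}     {suc zero} (suc zero) _   = inj₂ refl
  Fin2-one-of {suc zero} {zero}     zero       _   = inj₂ refl
  Fin2-one-of {suc zero} {zero}     (suc zero) _   = inj₁ refl

  Fin-≤2-cases : ∀ {m} → suc (suc m) ≤ 2 → (j : Fin (suc (suc m))) → j ≡ zero ⊎ j ≡ suc zero
  Fin-≤2-cases _ zero = inj₁ refl
  Fin-≤2-cases _ (suc zero) = inj₂ refl
  Fin-≤2-cases {suc _} (s≤s (s≤s ())) (suc (suc _))

module _ {n : ℕ} {f : Fin n → Bool} where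

  count-≤ : ∀ {m} (α : ∀ i → f i ≡ true → Fin m) →
            (∀ {i i′} t t′ → α i t ≡ α i′ t′ → i ≡ i′) → countF f ≤ m
  count-≤ α α-injective =
    injective⇒≤ {f = λ j → α (unrank f j) (unrank-true f j)}
                (λ e → unrank-injective f (α-injective _ _ e))

  count-≤-count : ∀ {m} {g : Fin m → Bool} (α : ∀ i → f i ≡ true → Fin m) →
                  (∀ i t → g (α i t) ≡ true) →
                  (∀ {i i′} t t′ → α i t ≡ α i′ t′ → i ≡ i′) → countF f ≤ countF g
  count-≤-count {g = g} α α-true α-injective =
    count-≤ (λ i t → position (α i t) (α-true i t))
            (λ t t′ e → α-injective t t′ (position-injective _ _ e))
    where open Enumeration g refl

  count-≤1 : (∀ {i j} → f i ≡ true → f j ≡ true → i ≡ j) → countF f ≤ 1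
  count-≤1 unique = count-≤ (λ _ _ → zero) (λ t t′ _ → unique t t′)

  count-≥1 : ∀ {i} → f i ≡ true → 1 ≤ countF f
  count-≥1 t = Fin-inhabited⇒1≤ (rank f _ t)

  count≤1⇒unique : countF f ≤ 1 → ∀ {i j} → f i ≡ true → f j ≡ true → i ≡ j
  count≤1⇒unique le t t′ = position-injective t t′ (Fin≤1-subsingleton le _ _)
    where open Enumeration f refl

  count-≥2 : ∀ {i j} → f i ≡ true → f j ≡ true → i ≢ j → 2 ≤ countF f
  count-≥2 t t′ i≢j = ≰⇒> (λ le → i≢j (count≤1⇒unique le t t′))

  count≡2⇒one-of : countF f ≡ 2 → ∀ {i j l} → f i ≡ true → f j ≡ true → i ≢ j →
                   f l ≡ true → l ≡ i ⊎ l ≡ j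
  count≡2⇒one-of count≡2 ti tj i≢j tl =
    Sum.map (position-injective tl ti) (position-injective tl tj)
            (Fin2-one-of (position _ tl) (i≢j ∘ position-injective ti tj))
    where open Enumeration f count≡2

  count≡1+⇒witness : ∀ {m} → countF f ≡ suc m → Σ (Fin n) λ i → f i ≡ true
  count≡1+⇒witness count≡ = element zero , element-true zero
    where open Enumeration f count≡

  count≡2+⇒two-witnesses : ∀ {m} → countF f ≡ suc (suc m) →
    Σ (Fin n) λ i → Σ (Fin n) λ j → f i ≡ true × f j ≡ true × i ≢ j
  count≡2+⇒two-witnesses count≡ =
    element zero , element (suc zero) , element-true zero , element-true (suc zero) ,
    0≢1+n ∘ element-injective
    where open Enumeration f count≡

count-complement : ∀ {n} (f : Fin n → Bool) → countF f + countF (not ∘ f) ≡ n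
count-complement {zero}  f = refl
count-complement {suc n} f with f zero
... | true  = cong suc (count-complement (f ∘ suc))
... | false = trans (+-suc _ _) (cong suc (count-complement (f ∘ suc)))

count-cong : ∀ {n} {f g : Fin n → Bool} → (∀ i → f i ≡ g i) → countF f ≡ countF g
count-cong {zero}  f≗g = refl
count-cong {suc n} f≗g = cong₂ _+_ (cong (λ b → if b then 1 else 0) (f≗g zero)) (count-cong (f≗g ∘ suc))

private
  true≢false : true ≢ false
  true≢false ()

  ∧-intro : ∀ {x y} → x ≡ true → y ≡ true → x ∧ y ≡ true
  ∧-intro refl refl = refl

  ∧-elim : ∀ x {y} → x ∧ y ≡ true → x ≡ true × y ≡ true
  ∧-elim true y≡true = refl , y≡true

  does-cases : ∀ {A : Set} (d : Dec A) → (does d ≡ true × A) ⊎ (does d ≡ false × ¬ A)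
  does-cases (yes a) = inj₁ (refl , a)
  does-cases (no ¬a) = inj₂ (refl , ¬a)

  ≢-≢⇒≡ : ∀ {x y z : Bool} → x ≢ y → x ≢ z → y ≡ z
  ≢-≢⇒≡ x≢y x≢z = not-injective (trans (sym (¬-not x≢y)) (¬-not x≢z))

  xor≡true⇒≢ : ∀ {x y} → x xor y ≡ true → x ≢ y
  xor≡true⇒≢ {true}  {true}  ()
  xor≡true⇒≢ {false} {false} ()

  ≢⇒xor≡true : ∀ {x y} → x ≢ y → x xor y ≡ true
  ≢⇒xor≡true {true}  {false} _ = refl
  ≢⇒xor≡true {false} {true}  _ = refl
  ≢⇒xor≡true {true}  {true}  x≢y = ⊥-elim (x≢y refl)
  ≢⇒xor≡true {false} {false} x≢y = ⊥-elim (x≢y refl)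

  not≡true⇒≡false : ∀ {x} → not x ≡ true → x ≡ false
  not≡true⇒≡false {false} _ = refl

  inj₂≢inj₁ : ∀ {A B : Set} {x : B} {y : A} → inj₂ x ≢ inj₁ y
  inj₂≢inj₁ ()

  bool-cases : ∀ x → x ≡ true ⊎ x ≡ false
  bool-cases true  = inj₁ refl
  bool-cases false = inj₂ refl

  0or1⇒≤1 : ∀ {n} → n ≡ 0 ⊎ n ≡ 1 → n ≤ 1
  0or1⇒≤1 (inj₁ refl) = z≤n
  0or1⇒≤1 (inj₂ refl) = s≤s z≤n

walk-0 : ∀ {G x y} → Walk G 0 x y → x ≡ y
walk-0 here = refl

walk-1 : ∀ {G x y} → Walk G 1 x y → Adj G x y
walk-1 (step a here) = a

common-neighbours-at-distance-1 : ∀ {G x y z} → Dist G x z 1 → Dist G y z 1 →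
  HasCard (λ w → Adj G x w × Adj G y w × Dist G z w 0) 1
common-neighbours-at-distance-1 {z = z} (xz , _) (yz , _) =
  z ∷ [] , [] ∷ [] , (λ w → mk⇔ (λ { (here refl) → walk-1 xz , walk-1 yz , here , λ _ () })
                                (λ (_ , _ , zw , _) → here (sym (walk-0 zw)))) , refl

no-elements⇒card-0 : ∀ {A : Set} {P : A → Set} → (∀ w → ¬ P w) → HasCard P 0
no-elements⇒card-0 ¬P = [] , [] , (λ w → mk⇔ (λ ()) (⊥-elim ∘ ¬P w)) , refl

module IncidenceWalks {v b : ℕ} (I : Incidence v b) where

  Meet : Fin b → Fin b → Set
  Meet B C = Σ (Fin v) λ p → I p B ≡ true × I p C ≡ true

  meet-sym : ∀ {B C} → Meet B C → Meet C B
  meet-sym (p , pB , pC) = p , pC , pB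

  Γ : Graph
  Γ = IncidenceGraph I

  adj-sym : ∀ x y → Adj Γ x y → Adj Γ y x
  adj-sym (inj₁ _) (inj₂ _) a = a
  adj-sym (inj₂ _) (inj₁ _) a = a

  walk-2-from-block : ∀ {B y} → Walk Γ 2 (inj₂ B) y → Σ (Fin b) λ C → y ≡ inj₂ C × Meet B C
  walk-2-from-block (step {y = inj₁ p} pB (step {y = inj₂ C} pC here)) = C , refl , p , pB , pC

  walk-2-to-point : ∀ {z q} → Walk Γ 2 z (inj₁ q) → Σ (Fin b) λ X → I q X ≡ true × Adj Γ z (inj₂ X)
  walk-2-to-point (step {y = inj₂ X} zX (step qX here)) = X , qX , zX

  no-walk-3-between-blocks : ∀ {B C} → ¬ Walk Γ 3 (inj₂ B) (inj₂ C)
  no-walk-3-between-blocks (step {y = inj₁ _} _ (step {y = inj₂ _} _ (step () here)))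

  walk-via-point : ∀ {n B C p z} → I p B ≡ true → I p C ≡ true → Walk Γ n (inj₂ C) z →
                   Walk Γ (suc (suc n)) (inj₂ B) z
  walk-via-point {p = p} pB pC w = step {y = inj₁ p} pB (step pC w)

module TwoRegularDesign {v b r k λ₁ t k′ : ℕ} (I : Incidence v b)
  (S : IsSPBIBD I r k λ₁ 0 (k ∸ 1) t) (Q : IsQuasiSymmetric I 0 1)
  (k≡2+k′ : k ≡ suc (suc k′)) (r≡2 : r ≡ 2) where

  open IsSPBIBD S
  open IsQuasiSymmetric Q
  open IncidenceWalks I

  meet-unique : ∀ {B C p q} → B ≢ C → I p B ≡ true → I p C ≡ true →
                I q B ≡ true → I q C ≡ true → p ≡ q
  meet-unique {B} {C} B≢C pB pC qB qC =
    count≤1⇒unique (0or1⇒≤1 (two-intersections B C B≢C)) (∧-intro pB pC) (∧-intro qB qC)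

  blocks-through : ∀ p → Σ (Fin b) λ P → Σ (Fin b) λ P′ → I p P ≡ true × I p P′ ≡ true × P ≢ P′
  blocks-through p = count≡2+⇒two-witnesses (trans (replication p) r≡2)

  block-one-of : ∀ {p P P′ X} → I p P ≡ true → I p P′ ≡ true → P ≢ P′ → I p X ≡ true →
                 X ≡ P ⊎ X ≡ P′
  block-one-of {p} = count≡2⇒one-of (trans (replication p) r≡2)

  another-block : ∀ {p C} → I p C ≡ true → Σ (Fin b) λ D → I p D ≡ true × D ≢ C
  another-block {p} {C} pC with blocks-through p
  ... | P , P′ , pP , pP′ , P≢P′ with P ≟ C
  ...   | yes refl = P′ , pP′ , P≢P′ ∘ sym
  ...   | no P≢C   = P , pP , P≢C

  points-on : ∀ B → Σ (Fin v) λ p → Σ (Fin v) λ q → I p B ≡ true × I q B ≡ true × p ≢ q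
  points-on B = count≡2+⇒two-witnesses (trans (block-size B) k≡2+k′)

  another-point : ∀ {p B} → I p B ≡ true → Σ (Fin v) λ q → I q B ≡ true × q ≢ p
  another-point {p} {B} pB with points-on B
  ... | q , q′ , qB , q′B , q≢q′ with q ≟ p
  ...   | yes refl = q′ , q′B , q≢q′ ∘ sym
  ...   | no q≢p   = q , qB , q≢p

  λ≤1 : ∀ {p q} → p ≢ q → λpq I p q ≤ 1
  λ≤1 {p} {q} p≢q = count-≤1 same-block
    where
    same-block : ∀ {X Y} → I p X ∧ I q X ≡ true → I p Y ∧ I q Y ≡ true → X ≡ Y
    same-block {X} {Y} pqX pqY with X ≟ Y
    ... | yes X≡Y = X≡Y
    ... | no X≢Y = ⊥-elim (p≢q (meet-unique X≢Y (proj₁ (∧-elim _ pqX)) (proj₁ (∧-elim _ pqY))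
                                                (proj₂ (∧-elim _ pqX)) (proj₂ (∧-elim _ pqY))))

  λ≡1-on-block : ∀ {p q X} → p ≢ q → I p X ≡ true → I q X ≡ true → λpq I p q ≡ 1
  λ≡1-on-block {p} {q} p≢q pX qX =
    ≤-antisym (λ≤1 p≢q) (count-≥1 {f = λ B → I p B ∧ I q B} (∧-intro pX qX))

  λ₁≡1 : λ₁ ≡ 1
  λ₁≡1 with points-on (proj₁ x-occurs)
  ... | p , q , pB , qB , p≢q with two-lambdas p q p≢q
  ...   | inj₁ λ≡λ₁ = trans (sym λ≡λ₁) (λ≡1-on-block p≢q pB qB)
  ...   | inj₂ λ≡0  = ⊥-elim (ℕ.0≢1+n (trans (sym λ≡0) (λ≡1-on-block p≢q pB qB)))

  associated : Fin v → Fin v → Bool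
  associated p q = λpq I p q ≡ᵇ λ₁

  associated-on-block : ∀ {p q X} → p ≢ q → I p X ≡ true → I q X ≡ true → associated p q ≡ true
  associated-on-block p≢q pX qX =
    Equivalence.to T-≡ (≡⇒≡ᵇ _ _ (trans (λ≡1-on-block p≢q pX qX) (sym λ₁≡1)))

  associated⇒common-block : ∀ {p q} → associated p q ≡ true →
                           Σ (Fin b) λ X → I p X ≡ true × I q X ≡ true
  associated⇒common-block {p} {q} col
    with count≡1+⇒witness (trans (≡ᵇ⇒≡ _ _ (Equivalence.from T-≡ col)) λ₁≡1)
  ... | X , pqX = X , ∧-elim _ pqX

  associated-on : Fin v → Fin b → Fin v → Bool
  associated-on p B q = I q B ∧ associated p q

  off-block : ∀ {p q B} → I p B ≡ false → I q B ≡ true → p ≢ q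
  off-block p∉B qB refl = true≢false (trans (sym qB) p∉B)

  t≥1 : 1 ≤ t
  t≥1 with points-on (proj₁ x-occurs)
  ... | p , q , pB , qB , p≢q with another-block qB
  ...   | C , qC , C≢B = subst (1 ≤_) (nonflag-count p C p∉C)
                                (count-≥1 {f = associated-on p C} (∧-intro qC (associated-on-block p≢q pB qB)))
    where
    p∉C : I p C ≡ false
    p∉C = ¬-not λ pC → p≢q (meet-unique C≢B pC pB qC qB)

  t≤1 : t ≤ 1
  t≤1 with x-occurs
  ... | B , B′ , B≢B′ , B∩B′≡0 with points-on B′
  ...   | p , _ , pB′ , _ = subst (_≤ 1) (nonflag-count p B p∉B) (count-≤1 unique)
    where
    disjoint : ∀ {q} → I q B ≡ true → I q B′ ≡ true → ⊥
    disjoint qB qB′ with subst (1 ≤_) B∩B′≡0 (count-≥1 {f = λ q → I q B ∧ I q B′} (∧-intro qB qB′))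
    ... | ()

    p∉B : I p B ≡ false
    p∉B = ¬-not λ pB → disjoint pB pB′

    unique : ∀ {q q′} → associated-on p B q ≡ true → associated-on p B q′ ≡ true → q ≡ q′
    unique {q} {q′} col col′
      with ∧-elim _ col | ∧-elim _ col′
    ... | qB , pq | q′B , pq′
      with associated⇒common-block pq | associated⇒common-block pq′
    ... | X , pX , qX | X′ , pX′ , q′X′
      with block-one-of pB′ pX (λ { refl → disjoint qB qX }) pX′
    ... | inj₁ refl = ⊥-elim (disjoint q′B q′X′)
    ... | inj₂ refl = meet-unique (λ { refl → true≢false (trans (sym pX) p∉B) }) qX qB q′X′ q′B

  t≡1 : t ≡ 1
  t≡1 = ≤-antisym t≤1 t≥1

  meeting-block : ∀ {p B} → I p B ≡ false → Σ (Fin b) λ X → I p X ≡ true × Meet B X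
  meeting-block {p} {B} p∉B with count≡1+⇒witness (trans (nonflag-count p B p∉B) t≡1)
  ... | q , col with ∧-elim _ col
  ...   | qB , pq with associated⇒common-block pq
  ...     | X , pX , qX = X , pX , q , qB , qX

  meeting-block-unique : ∀ {p B P P′} → I p B ≡ false → I p P ≡ true → I p P′ ≡ true → P ≢ P′ →
                         Meet B P → Meet B P′ → ⊥
  meeting-block-unique {p} {B} {P} {P′} p∉B pP pP′ P≢P′ (q , qB , qP) (q′ , q′B , q′P′) =
    off-block p∉B qB (meet-unique P≢P′ pP pP′ qP (subst (λ x → I x P′ ≡ true) (sym q≡q′) q′P′))
    where
    q≡q′ : q ≡ q′
    q≡q′ = count≤1⇒unique (≤-reflexive (trans (nonflag-count p B p∉B) t≡1))
             (∧-intro qB (associated-on-block (off-block p∉B qB) pP qP))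
             (∧-intro q′B (associated-on-block (off-block p∉B q′B) pP′ q′P′))

  B₀ : Fin b
  B₀ = proj₁ x-occurs

  Near : Fin b → Set
  Near B = B ≢ B₀ × Meet B B₀

  meet? : ∀ B C → Dec (Meet B C)
  meet? B C = any? λ p → (I p B Bool.≟ true) ×-dec (I p C Bool.≟ true)

  near? : ∀ B → Dec (Near B)
  near? B = ¬? (B ≟ B₀) ×-dec meet? B B₀

  opaque
    side : Fin b → Bool
    side B = does (near? B)

    side-cases : ∀ B → (side B ≡ true × Near B) ⊎ (side B ≡ false × ¬ Near B)
    side-cases B = does-cases (near? B)

  near-near-disjoint : ∀ {B C} → B ≢ C → Near B → Near C → ¬ Meet B C
  near-near-disjoint B≢C (B≢B₀ , B∩B₀) (C≢B₀ , C∩B₀) (q , qB , qC) =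
    meeting-block-unique q∉B₀ qB qC B≢C (meet-sym B∩B₀) (meet-sym C∩B₀)
    where
    q∉B₀ : I q B₀ ≡ false
    q∉B₀ = ¬-not λ qB₀ → Sum.[ B≢B₀ ∘ sym , C≢B₀ ∘ sym ] (block-one-of qB qC B≢C qB₀)

  far-far-disjoint : ∀ {B C} → B ≢ C → ¬ Near B → ¬ Near C → ¬ Meet B C
  far-far-disjoint {B} {C} B≢C ¬nearB ¬nearC (q , qB , qC) with B ≟ B₀ | C ≟ B₀
  ... | yes B≡B₀ | _ =
    ¬nearC ((λ C≡B₀ → B≢C (trans B≡B₀ (sym C≡B₀))) , q , qC , subst (λ X → I q X ≡ true) B≡B₀ qB)
  ... | no _ | yes C≡B₀ =
    ¬nearB ((λ B≡B₀ → B≢C (trans B≡B₀ (sym C≡B₀))) , q , qB , subst (λ X → I q X ≡ true) C≡B₀ qC)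
  ... | no B≢B₀ | no C≢B₀ = through-q (meeting-block q∉B₀)
    where
    q∉B₀ : I q B₀ ≡ false
    q∉B₀ = ¬-not λ qB₀ → ¬nearB (B≢B₀ , q , qB , qB₀)

    through-q : (Σ (Fin b) λ X → I q X ≡ true × Meet B₀ X) → ⊥
    through-q (X , qX , B₀∩X) =
      Sum.[ (λ X≡B → ¬nearB (B≢B₀ , subst (λ Y → Meet Y B₀) X≡B (meet-sym B₀∩X)))
          , (λ X≡C → ¬nearC (C≢B₀ , subst (λ Y → Meet Y B₀) X≡C (meet-sym B₀∩X))) ]
          (block-one-of qB qC B≢C qX)

  near-far-meet : ∀ {B C} → Near B → ¬ Near C → Meet B C
  near-far-meet {B} {C} (B≢B₀ , p , pB , pB₀) ¬nearC with C ≟ B₀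
  ... | yes C≡B₀ = p , pB , subst (λ X → I p X ≡ true) (sym C≡B₀) pB₀
  ... | no C≢B₀ = through-p (meeting-block p∉C)
    where
    p∉C : I p C ≡ false
    p∉C = ¬-not λ pC → ¬nearC (C≢B₀ , p , pC , pB₀)

    through-p : (Σ (Fin b) λ X → I p X ≡ true × Meet C X) → Meet B C
    through-p (X , pX , C∩X) =
      Sum.[ (λ X≡B → meet-sym (subst (Meet C) X≡B C∩X))
          , (λ X≡B₀ → ⊥-elim (¬nearC (C≢B₀ , subst (Meet C) X≡B₀ C∩X))) ]
          (block-one-of pB pB₀ B≢B₀ pX)

  same-side-disjoint : ∀ {B C} → B ≢ C → side B ≡ side C → ¬ Meet B C
  same-side-disjoint {B} {C} B≢C same with side-cases B | side-cases C
  ... | inj₁ (_ , nearB)  | inj₁ (_ , nearC)  = near-near-disjoint B≢C nearB nearC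
  ... | inj₂ (_ , ¬nearB) | inj₂ (_ , ¬nearC) = far-far-disjoint B≢C ¬nearB ¬nearC
  ... | inj₁ (sB , _)     | inj₂ (sC , _)     = ⊥-elim (true≢false (trans (sym sB) (trans same sC)))
  ... | inj₂ (sB , _)     | inj₁ (sC , _)     = ⊥-elim (true≢false (trans (sym sC) (trans (sym same) sB)))

  opposite-sides-meet : ∀ {B C} → side B ≢ side C → Meet B C
  opposite-sides-meet {B} {C} opposite with side-cases B | side-cases C
  ... | inj₁ (_ , nearB)  | inj₂ (_ , ¬nearC) = near-far-meet nearB ¬nearC
  ... | inj₂ (_ , ¬nearB) | inj₁ (_ , nearC)  = meet-sym (near-far-meet nearC ¬nearB)
  ... | inj₁ (sB , _)     | inj₁ (sC , _)     = ⊥-elim (opposite (trans sB (sym sC)))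
  ... | inj₂ (sB , _)     | inj₂ (sC , _)     = ⊥-elim (opposite (trans sB (sym sC)))

  meet⇒opposite-sides : ∀ {B C} → B ≢ C → Meet B C → side B ≢ side C
  meet⇒opposite-sides B≢C B∩C same = same-side-disjoint B≢C same B∩C

  same-side-through-point : ∀ {p Y Y′} → I p Y ≡ true → I p Y′ ≡ true → side Y ≡ side Y′ → Y ≡ Y′
  same-side-through-point {p} {Y} {Y′} pY pY′ same with Y ≟ Y′
  ... | yes Y≡Y′ = Y≡Y′
  ... | no Y≢Y′  = ⊥-elim (meet⇒opposite-sides Y≢Y′ (p , pY , pY′) same)

  block-on-side : ∀ c p → Σ (Fin b) λ X → I p X ≡ true × side X ≡ c
  block-on-side c p with blocks-through p
  ... | P , P′ , pP , pP′ , P≢P′ with side P Bool.≟ c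
  ...   | yes sP≡c = P , pP , sP≡c
  ...   | no sP≢c  = P′ , pP′ , ≢-≢⇒≡ (meet⇒opposite-sides P≢P′ (p , pP , pP′)) sP≢c

  -- The blocks on the other side of C are those meeting C, one through each point of C.
  opposite-side-count : ∀ C → countF (λ B → side B xor side C) ≡ k
  opposite-side-count C = trans (≤-antisym
    (count-≤-count meeting-point meeting-point-on-C meeting-point-injective)
    (count-≤-count other-block other-block-opposite other-block-injective))
    (block-size C)
    where
    meeting-point : ∀ B → side B xor side C ≡ true → Fin v
    meeting-point B o = proj₁ (opposite-sides-meet (xor≡true⇒≢ o))

    meeting-point-on-C : ∀ B o → I (meeting-point B o) C ≡ true
    meeting-point-on-C B o = proj₂ (proj₂ (opposite-sides-meet (xor≡true⇒≢ o)))

    meeting-point-injective : ∀ {B B′} o o′ → meeting-point B o ≡ meeting-point B′ o′ → B ≡ B′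
    meeting-point-injective {B} {B′} o o′ e =
      Sum.[ sym , (λ B′≡C → ⊥-elim (xor≡true⇒≢ o′ (cong side B′≡C))) ]
          (block-one-of (proj₁ (proj₂ B∩C)) (proj₂ (proj₂ B∩C)) (xor≡true⇒≢ o ∘ cong side) pB′)
      where
      B∩C  = opposite-sides-meet (xor≡true⇒≢ o)
      B′∩C = opposite-sides-meet (xor≡true⇒≢ o′)
      pB′ : I (proj₁ B∩C) B′ ≡ true
      pB′ = subst (λ x → I x B′ ≡ true) (sym e) (proj₁ (proj₂ B′∩C))

    other-block : ∀ p → I p C ≡ true → Fin b
    other-block p pC = proj₁ (another-block pC)

    other-block-opposite : ∀ p pC → side (other-block p pC) xor side C ≡ true
    other-block-opposite p pC with another-block pC
    ... | D , pD , D≢C = ≢⇒xor≡true (meet⇒opposite-sides D≢C (p , pD , pC))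

    other-block-injective : ∀ {p p′} pC p′C → other-block p pC ≡ other-block p′ p′C → p ≡ p′
    other-block-injective pC p′C e with another-block pC | another-block p′C
    ... | D , pD , D≢C | _ , p′D , _ = meet-unique D≢C pD pC (subst (λ X → I _ X ≡ true) (sym e) p′D) p′C

  near⇒side≡true : ∀ {B} → Near B → side B ≡ true
  near⇒side≡true {B} nearB with side-cases B
  ... | inj₁ (sB , _)      = sB
  ... | inj₂ (_ , ¬nearB) = ⊥-elim (¬nearB nearB)

  side-B₀ : side B₀ ≡ false
  side-B₀ with side-cases B₀
  ... | inj₁ (_ , B₀≢B₀ , _) = ⊥-elim (B₀≢B₀ refl)
  ... | inj₂ (sB₀ , _)        = sB₀

  near-block : Σ (Fin b) λ D → side D ≡ true
  near-block with points-on B₀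
  ... | p , _ , pB₀ , _ with another-block pB₀
  ...   | D , pD , D≢B₀ = D , near⇒side≡true (D≢B₀ , p , pD , pB₀)

  side-count : countF side ≡ k
  side-count = trans (count-cong same) (opposite-side-count B₀)
    where
    same : ∀ B → side B ≡ side B xor side B₀
    same B = sym (trans (cong (side B xor_) side-B₀) (xor-identityʳ (side B)))

  other-side-count : countF (not ∘ side) ≡ k
  other-side-count = trans (count-cong flipped) (opposite-side-count (proj₁ near-block))
    where
    flipped : ∀ B → not (side B) ≡ side B xor side (proj₁ near-block)
    flipped B = sym (begin
      side B xor side (proj₁ near-block) ≡⟨ cong (side B xor_) (proj₂ near-block) ⟩
      side B xor true                    ≡⟨ xor-comm (side B) true ⟩
      true xor side B                    ≡⟨ true-xor (side B) ⟩
      not (side B)                       ∎)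
      where open ≡-Reasoning

  b≡2k : b ≡ 2 * k
  b≡2k = begin
    b                                  ≡⟨ count-complement side ⟨
    countF side + countF (not ∘ side)  ≡⟨ cong₂ _+_ side-count other-side-count ⟩
    k + k                              ≡⟨ cong (k +_) (+-identityʳ k) ⟨
    2 * k                              ∎
    where open ≡-Reasoning

  module Left  = Enumeration side side-count
  module Right = Enumeration (not ∘ side) other-side-count

  opaque
    blockVertexOn : ∀ B c → side B ≡ c → Fin k ⊎ Fin k
    blockVertexOn B true  s = inj₁ (Left.position B s)
    blockVertexOn B false s = inj₂ (Right.position B (cong not s))

    blockVertex : Fin b → Fin k ⊎ Fin k
    blockVertex B = blockVertexOn B (side B) refl

    blockVertex-left : ∀ {B} (s : side B ≡ true) → blockVertex B ≡ inj₁ (Left.position B s)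
    blockVertex-left {B} = on-left (side B) refl
      where
      on-left : ∀ c (s′ : side B ≡ c) (s : side B ≡ true) → blockVertexOn B c s′ ≡ inj₁ (Left.position B s)
      on-left true  s′ s = cong inj₁ (Left.position-cong s′ s refl)
      on-left false s′ s = ⊥-elim (true≢false (trans (sym s) s′))

    blockVertex-right : ∀ {B} (s : side B ≡ false) → blockVertex B ≡ inj₂ (Right.position B (cong not s))
    blockVertex-right {B} = on-right (side B) refl
      where
      on-right : ∀ c (s′ : side B ≡ c) (s : side B ≡ false) →
                 blockVertexOn B c s′ ≡ inj₂ (Right.position B (cong not s))
      on-right true  s′ s = ⊥-elim (true≢false (trans (sym s′) s))
      on-right false s′ s = cong inj₂ (Right.position-cong (cong not s′) (cong not s) refl)

  leftBlock rightBlock : Fin v → Fin b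
  leftBlock  = proj₁ ∘ block-on-side true
  rightBlock = proj₁ ∘ block-on-side false

  leftBlock-in : ∀ p → I p (leftBlock p) ≡ true
  leftBlock-in = proj₁ ∘ proj₂ ∘ block-on-side true

  rightBlock-in : ∀ p → I p (rightBlock p) ≡ true
  rightBlock-in = proj₁ ∘ proj₂ ∘ block-on-side false

  leftBlock-side : ∀ p → side (leftBlock p) ≡ true
  leftBlock-side = proj₂ ∘ proj₂ ∘ block-on-side true

  rightBlock-side : ∀ p → side (rightBlock p) ≡ false
  rightBlock-side = proj₂ ∘ proj₂ ∘ block-on-side false

  pointVertex : Fin v → Fin k × Fin k
  pointVertex p = Left.position (leftBlock p) (leftBlock-side p) ,
                  Right.position (rightBlock p) (cong not (rightBlock-side p))

  left-side : ∀ i → side (Left.element i) ≡ true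
  left-side = Left.element-true

  right-side : ∀ j → side (Right.element j) ≡ false
  right-side j = not≡true⇒≡false (Right.element-true j)

  corner : ∀ i j → Meet (Left.element i) (Right.element j)
  corner i j = opposite-sides-meet λ e → true≢false (trans (sym (left-side i)) (trans e (right-side j)))

  leftBlock-unique : ∀ {p B} → I p B ≡ true → side B ≡ true → leftBlock p ≡ B
  leftBlock-unique {p} pB s = same-side-through-point (leftBlock-in p) pB (trans (leftBlock-side p) (sym s))

  rightBlock-unique : ∀ {p B} → I p B ≡ true → side B ≡ false → rightBlock p ≡ B
  rightBlock-unique {p} pB s = same-side-through-point (rightBlock-in p) pB (trans (rightBlock-side p) (sym s))

  K : EdgeGraph
  K = CompleteBipartite k k

  vertex : Fin v ⊎ Fin b → V (Subdivision K)
  vertex (inj₁ p) = inj₂ (pointVertex p)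
  vertex (inj₂ B) = inj₁ (blockVertex B)

  vertex⁻¹ : V (Subdivision K) → Fin v ⊎ Fin b
  vertex⁻¹ (inj₁ (inj₁ i)) = inj₂ (Left.element i)
  vertex⁻¹ (inj₁ (inj₂ j)) = inj₂ (Right.element j)
  vertex⁻¹ (inj₂ (i , j))  = inj₁ (proj₁ (corner i j))

  vertex⁻¹-vertex : ∀ x → vertex⁻¹ (vertex x) ≡ x
  vertex⁻¹-vertex (inj₁ p) =
    cong inj₁ (meet-unique left≢right
      (subst (λ X → I q X ≡ true) (Left.element-position _ _) (proj₁ (proj₂ q-corner)))
      (subst (λ X → I q X ≡ true) (Right.element-position _ _) (proj₂ (proj₂ q-corner)))
      (leftBlock-in p) (rightBlock-in p))
    where
    q-corner = corner (proj₁ (pointVertex p)) (proj₂ (pointVertex p))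
    q = proj₁ q-corner
    left≢right : leftBlock p ≢ rightBlock p
    left≢right e = true≢false (trans (sym (leftBlock-side p)) (trans (cong side e) (rightBlock-side p)))
  vertex⁻¹-vertex (inj₂ B) with bool-cases (side B)
  ... | inj₁ s = trans (cong (vertex⁻¹ ∘ inj₁) (blockVertex-left s)) (cong inj₂ (Left.element-position B s))
  ... | inj₂ s = trans (cong (vertex⁻¹ ∘ inj₁) (blockVertex-right s))
                       (cong inj₂ (Right.element-position B (cong not s)))

  vertex-vertex⁻¹ : ∀ y → vertex (vertex⁻¹ y) ≡ y
  vertex-vertex⁻¹ (inj₁ (inj₁ i)) =
    trans (cong inj₁ (blockVertex-left (left-side i))) (cong (inj₁ ∘ inj₁) (Left.position-element i _))
  vertex-vertex⁻¹ (inj₁ (inj₂ j)) =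
    trans (cong inj₁ (blockVertex-right (right-side j))) (cong (inj₁ ∘ inj₂) (Right.position-element j _))
  vertex-vertex⁻¹ (inj₂ (i , j)) = cong inj₂ (cong₂ _,_
    (trans (Left.position-cong _ (left-side i) (leftBlock-unique qi (left-side i))) (Left.position-element i _))
    (trans (Right.position-cong _ (Right.element-true j) (rightBlock-unique qj (right-side j)))
           (Right.position-element j _)))
    where
    qi = proj₁ (proj₂ (corner i j))
    qj = proj₂ (proj₂ (corner i j))

  incident⇒adjacent : ∀ {p B} → I p B ≡ true → Adj (Subdivision K) (vertex (inj₁ p)) (vertex (inj₂ B))
  incident⇒adjacent {p} {B} pB = Sum.[ on-left , on-right ]′ (bool-cases (side B))
    where
    on-left : side B ≡ true → Adj (Subdivision K) (vertex (inj₁ p)) (vertex (inj₂ B))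
    on-left s = inj₁ (trans (cong inj₁ (Left.position-cong (leftBlock-side p) s (leftBlock-unique pB s)))
                            (sym (blockVertex-left s)))
    on-right : side B ≡ false → Adj (Subdivision K) (vertex (inj₁ p)) (vertex (inj₂ B))
    on-right s = inj₂ (trans (cong inj₂ (Right.position-cong (cong not (rightBlock-side p)) (cong not s)
                                                               (rightBlock-unique pB s)))
                             (sym (blockVertex-right s)))

  adjacent⇒incident : ∀ {p B} → Adj (Subdivision K) (vertex (inj₁ p)) (vertex (inj₂ B)) → I p B ≡ true
  adjacent⇒incident {p} {B} adj = Sum.[ on-left , on-right ]′ (bool-cases (side B))
    where
    on-left : side B ≡ true → I p B ≡ true
    on-left s = Sum.[ (λ e → subst (λ X → I p X ≡ true)
                                   (Left.position-injective (leftBlock-side p) s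
                                      (inj₁-injective (trans e (blockVertex-left s))))
                                   (leftBlock-in p))
                    , (λ e → ⊥-elim (inj₂≢inj₁ (trans e (blockVertex-left s)))) ]′ adj
    on-right : side B ≡ false → I p B ≡ true
    on-right s = Sum.[ (λ e → ⊥-elim (inj₂≢inj₁ (sym (trans e (blockVertex-right s)))))
                     , (λ e → subst (λ X → I p X ≡ true)
                                    (Right.position-injective (cong not (rightBlock-side p)) (cong not s)
                                       (inj₂-injective (trans e (blockVertex-right s))))
                                    (rightBlock-in p)) ]′ adj

  ≅-subdivision : IncidenceGraph I ≅ Subdivision K
  ≅-subdivision = record
    { bij       = ↔⇒⤖ (mk↔ₛ′ vertex vertex⁻¹ vertex-vertex⁻¹ vertex⁻¹-vertex)
    ; preserves = preserves
    ; reflects  = reflects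
    }
    where
    preserves : ∀ x y → Adj (IncidenceGraph I) x y → Adj (Subdivision K) (vertex x) (vertex y)
    preserves (inj₁ p) (inj₂ B) pB = incident⇒adjacent pB
    preserves (inj₂ B) (inj₁ p) pB = incident⇒adjacent pB

    reflects : ∀ x y → Adj (Subdivision K) (vertex x) (vertex y) → Adj (IncidenceGraph I) x y
    reflects (inj₁ p) (inj₂ B) adj = adjacent⇒incident adj
    reflects (inj₂ B) (inj₁ p) adj = adjacent⇒incident adj

  block-through-meeting : ∀ B p → Σ (Fin b) λ X → I p X ≡ true × Meet B X
  block-through-meeting B p with block-on-side (not (side B)) p
  ... | X , pX , sX = X , pX , opposite-sides-meet λ e → not-¬ refl (trans e sX)

  walk-3-to-point : ∀ B q → Walk Γ 3 (inj₂ B) (inj₁ q)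
  walk-3-to-point B q with block-through-meeting B q
  ... | X , qX , p , pB , pX = walk-via-point pB pX (step qX here)

  walk-4-between-blocks : ∀ B C → Walk Γ 4 (inj₂ B) (inj₂ C)
  walk-4-between-blocks B C with points-on B
  ... | p , _ , pB , _ with block-through-meeting C p
  ...   | X , pX , q , qC , qX = walk-via-point pB pX (walk-via-point qX qC here)

  same-side-block : ∀ B → Σ (Fin b) λ C → C ≢ B × side C ≡ side B
  same-side-block B with points-on B
  ... | p , _ , pB , _ with another-block pB
  ...   | X , pX , X≢B with another-point pX
  ...     | q , qX , q≢p with another-block qX
  ...       | C , qC , C≢X =
    C , C≢B , ≢-≢⇒≡ (meet⇒opposite-sides (C≢X ∘ sym) (q , qX , qC)) (meet⇒opposite-sides X≢B (p , pX , pB))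
    where
    C≢B : C ≢ B
    C≢B refl = q≢p (meet-unique X≢B qX qC pX pB)

  dist-4-same-side : ∀ {B C} → C ≢ B → side C ≡ side B → Dist Γ (inj₂ B) (inj₂ C) 4
  dist-4-same-side {B} {C} C≢B same = walk-4-between-blocks B C , shorter
    where
    shorter : ∀ m → m < 4 → ¬ Walk Γ m (inj₂ B) (inj₂ C)
    shorter 0 _ w = C≢B (sym (inj₂-injective (walk-0 w)))
    shorter 1 _ w = walk-1 w
    shorter 2 _ w with walk-2-from-block w
    ... | _ , refl , B∩C = meet⇒opposite-sides (C≢B ∘ sym) B∩C (sym same)
    shorter 3 _ w = no-walk-3-between-blocks w
    shorter (suc (suc (suc (suc _)))) (s≤s (s≤s (s≤s (s≤s ()))))

  dist-2-opposite-sides : ∀ {B C} → C ≢ B → side C ≢ side B → Dist Γ (inj₂ B) (inj₂ C) 2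
  dist-2-opposite-sides {B} {C} C≢B opposite = walk , shorter
    where
    walk : Walk Γ 2 (inj₂ B) (inj₂ C)
    walk = let (p , pB , pC) = opposite-sides-meet (opposite ∘ sym) in walk-via-point pB pC here
    shorter : ∀ m → m < 2 → ¬ Walk Γ m (inj₂ B) (inj₂ C)
    shorter 0 _ w = C≢B (sym (inj₂-injective (walk-0 w)))
    shorter 1 _ w = walk-1 w
    shorter (suc (suc _)) (s≤s (s≤s ()))

  dist-3-off-block : ∀ {B q} → I q B ≡ false → Dist Γ (inj₂ B) (inj₁ q) 3
  dist-3-off-block {B} {q} q∉B = walk-3-to-point B q , shorter
    where
    shorter : ∀ m → m < 3 → ¬ Walk Γ m (inj₂ B) (inj₁ q)
    shorter 1 _ w = true≢false (trans (sym (walk-1 w)) q∉B)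
    shorter 2 _ w with walk-2-from-block w
    ... | _ , () , _
    shorter (suc (suc (suc _))) (s≤s (s≤s (s≤s ())))

  distance-from-block : ∀ B y → Σ ℕ λ m → m ≤ 4 × Dist Γ (inj₂ B) y m
  distance-from-block B (inj₁ q) with bool-cases (I q B)
  ... | inj₁ qB  = 1 , s≤s z≤n , step qB here , λ { 0 _ () ; (suc _) (s≤s ()) }
  ... | inj₂ q∉B = 3 , s≤s (s≤s (s≤s z≤n)) , dist-3-off-block q∉B
  distance-from-block B (inj₂ C) with C ≟ B | side C Bool.≟ side B
  ... | yes refl | _        = 0 , z≤n , here , λ _ ()
  ... | no C≢B   | yes same = 4 , ≤-refl , dist-4-same-side C≢B same
  ... | no C≢B   | no opp   = 2 , s≤s (s≤s z≤n) , dist-2-opposite-sides C≢B opp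

  block-eccentricity : ∀ B → Eccentricity Γ (inj₂ B) 4
  block-eccentricity B =
    distance-from-block B , inj₂ C , dist-4-same-side (proj₁ (proj₂ far)) (proj₂ (proj₂ far))
    where
    far = same-side-block B
    C = proj₁ far

  dist-2-from-block : ∀ {B y} → Dist Γ (inj₂ B) y 2 → Σ (Fin b) λ C → y ≡ inj₂ C × side B ≢ side C
  dist-2-from-block (w , shorter) with walk-2-from-block w
  ... | C , refl , B∩C = C , refl , meet⇒opposite-sides (λ { refl → shorter 0 (s≤s z≤n) here }) B∩C

  no-triangle-at-distance-2 : ∀ {B y z} → Dist Γ (inj₂ B) y 2 → Dist Γ (inj₂ B) z 2 → ¬ Dist Γ y z 2
  no-triangle-at-distance-2 By Bz yz with dist-2-from-block By | dist-2-from-block Bz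
  ... | C , refl , B|C | Z , refl , B|Z with dist-2-from-block yz
  ...   | _ , refl , C|Z = C|Z (≢-≢⇒≡ B|C B|Z)

  no-common-neighbour-at-distance-2 : ∀ {B y z} → Dist Γ (inj₂ B) y 2 → Dist Γ (inj₂ B) z 3 →
    Dist Γ y z 3 → ∀ w → ¬ (Adj Γ (inj₂ B) w × Adj Γ y w × Dist Γ z w 2)
  no-common-neighbour-at-distance-2 {B} {z = z} By (_ , B-shorter) (_ , y-shorter) (inj₁ q) (qB , qy , (zq , _))
    with dist-2-from-block By
  ... | C , refl , B|C with walk-2-to-point zq
  ...   | X , qX , zX with block-one-of qB qy (B|C ∘ cong side) qX
  ...     | inj₁ refl = B-shorter 1 (s≤s (s≤s z≤n)) (step (adj-sym z (inj₂ X) zX) here)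
  ...     | inj₂ refl = y-shorter 1 (s≤s (s≤s z≤n)) (step (adj-sym z (inj₂ X) zX) here)

  block-homogeneous : TwoHomogeneous Γ IsBlock
  block-homogeneous = 4 , s≤s (s≤s (s≤s z≤n)) , (λ { (inj₂ B) _ → block-eccentricity B }) , counts
    where
    counts : ∀ i → 1 ≤ i → i ≤ 3 → Σ ℕ λ c → ∀ x y z → IsBlock x → Dist Γ x y 2 → Dist Γ x z i →
             Dist Γ y z i → HasCard (λ w → Adj Γ x w × Adj Γ y w × Dist Γ z w (i ∸ 1)) c
    counts 1 _ _ = 1 , λ _ _ _ _ _ → common-neighbours-at-distance-1
    counts 2 _ _ = 0 , λ { (inj₂ B) _ _ _ By Bz yz → ⊥-elim (no-triangle-at-distance-2 By Bz yz) }
    counts 3 _ _ = 0 , λ { (inj₂ B) _ _ _ By Bz yz → no-elements⇒card-0 (no-common-neighbour-at-distance-2 By Bz yz) }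
    counts (suc (suc (suc (suc _)))) _ (s≤s (s≤s (s≤s ())))

module SubdividedCompleteBipartite (m : ℕ) where

  T : Graph
  T = Subdivision (CompleteBipartite m m)

  incident-edge : Fin m ⊎ Fin m → Fin m → Fin m × Fin m
  incident-edge (inj₁ i) j = i , j
  incident-edge (inj₂ i) j = j , i

  incident-edge-adjacent : ∀ u j → Adj T (inj₁ u) (inj₂ (incident-edge u j))
  incident-edge-adjacent (inj₁ i) j = inj₁ refl
  incident-edge-adjacent (inj₂ i) j = inj₂ refl

  incident-edge-injective : ∀ u {j j′} → incident-edge u j ≡ incident-edge u j′ → j ≡ j′
  incident-edge-injective (inj₁ i) refl = refl
  incident-edge-injective (inj₂ i) refl = refl

  vertex-neighbour : ∀ u w → Adj T (inj₁ u) w → Σ (Fin m) λ j → w ≡ inj₂ (incident-edge u j)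
  vertex-neighbour (inj₁ i) (inj₂ (_ , j)) (inj₁ refl) = j , refl
  vertex-neighbour (inj₂ i) (inj₂ (j , _)) (inj₂ refl) = j , refl

  edge-neighbour : ∀ e w → Adj T (inj₂ e) w → w ≡ inj₁ (inj₁ (proj₁ e)) ⊎ w ≡ inj₁ (inj₂ (proj₂ e))
  edge-neighbour (i , j) (inj₁ _) (inj₁ refl) = inj₁ refl
  edge-neighbour (i , j) (inj₁ _) (inj₂ refl) = inj₂ refl

module FromSubdivision {v b k′ : ℕ} (I : Incidence v b)
  (iso : IncidenceGraph I ≅ Subdivision (CompleteBipartite (suc (suc k′)) (suc (suc k′)))) where

  open SubdividedCompleteBipartite (suc (suc k′))
  open IncidenceWalks I using (Γ)
  open _≅_ iso using (f; preserves; reflects)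

  f-injective : ∀ {x y} → f x ≡ f y → x ≡ y
  f-injective = Bijection.injective (_≅_.bij iso)

  preimage : ∀ y → Σ (V Γ) λ x → f x ≡ y
  preimage y = let (x , fx≡y) = Bijection.surjective (_≅_.bij iso) y in x , fx≡y refl

  block-at : ∀ {p y} → Adj T (f (inj₁ p)) y → Σ (Fin b) λ B → I p B ≡ true × f (inj₂ B) ≡ y
  block-at {p} {y} adj with preimage y
  ... | inj₂ B , fB≡y = B , reflects (inj₁ p) (inj₂ B) (subst (Adj T (f (inj₁ p))) (sym fB≡y) adj) , fB≡y
  ... | inj₁ q , fq≡y = ⊥-elim (reflects (inj₁ p) (inj₁ q) (subst (Adj T (f (inj₁ p))) (sym fq≡y) adj))

  count≤2-by-image : ∀ {n} {g : Fin n → Bool} c (emb : Fin n → V Γ) →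
    (∀ {i j} → emb i ≡ emb j → i ≡ j) → (∀ i → g i ≡ true → Adj Γ c (emb i)) →
    ∀ {y₁ y₂} → (∀ w → Adj T (f c) w → w ≡ y₁ ⊎ w ≡ y₂) → countF g ≤ 2
  count≤2-by-image c emb emb-injective adj neighbours = count-≤ which which-injective
    where
    which : ∀ i → _ → Fin 2
    which i t = Sum.[ (λ _ → zero) , (λ _ → suc zero) ]′ (neighbours _ (preserves c (emb i) (adj i t)))

    which-injective : ∀ {i i′} t t′ → which i t ≡ which i′ t′ → i ≡ i′
    which-injective {i} {i′} t t′ e
      with neighbours _ (preserves c (emb i) (adj i t)) | neighbours _ (preserves c (emb i′) (adj i′ t′))
    ... | inj₁ e₁ | inj₁ e₂ = emb-injective (f-injective (trans e₁ (sym e₂)))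
    ... | inj₂ e₁ | inj₂ e₂ = emb-injective (f-injective (trans e₁ (sym e₂)))
    ... | inj₁ _  | inj₂ _  = ⊥-elim (0≢1+n e)
    ... | inj₂ _  | inj₁ _  = ⊥-elim (0≢1+n (sym e))

  point-degree-2 : ∀ p {y₁ y₂} → y₁ ≢ y₂ → Adj T (f (inj₁ p)) y₁ → Adj T (f (inj₁ p)) y₂ →
                   (∀ w → Adj T (f (inj₁ p)) w → w ≡ y₁ ⊎ w ≡ y₂) → pointDeg I p ≡ 2
  point-degree-2 p y₁≢y₂ a₁ a₂ neighbours with block-at a₁ | block-at a₂
  ... | B₁ , pB₁ , fB₁ | B₂ , pB₂ , fB₂ =
    ≤-antisym (count≤2-by-image {g = λ B → I p B} (inj₁ p) inj₂ inj₂-injective (λ _ t → t) neighbours)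
              (count-≥2 {f = λ B → I p B} pB₁ pB₂ λ { refl → y₁≢y₂ (trans (sym fB₁) fB₂) })

  block-size≤2 : ∀ B {e} → f (inj₂ B) ≡ inj₂ e → blockSize I B ≤ 2
  block-size≤2 B {e} fB =
    count≤2-by-image {g = λ q → I q B} (inj₂ B) inj₁ inj₁-injective (λ _ t → t)
      (λ w a → edge-neighbour e w (subst (λ y → Adj T y w) fB a))

  point-degree : (∀ B → blockSize I B ≡ suc (suc k′)) → ∀ p → pointDeg I p ≡ 2
  point-degree block-size p with f (inj₁ p) in fp
  ... | inj₂ (i , j) =
    point-degree-2 p (λ ()) (at-p (inj₁ refl)) (at-p (inj₂ refl))
      (λ w a → edge-neighbour (i , j) w (subst (λ y → Adj T y w) fp a))
    where
    at-p : ∀ {w} → Adj T (inj₂ (i , j)) w → Adj T (f (inj₁ p)) w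
    at-p {w} = subst (λ y → Adj T y w) (sym fp)
  ... | inj₁ u =
    point-degree-2 p (0≢1+n ∘ incident-edge-injective u ∘ inj₂-injective)
      (at-p (incident-edge-adjacent u zero)) (at-p (incident-edge-adjacent u (suc zero)))
      (λ w a → two-neighbours w (vertex-neighbour u w (subst (λ y → Adj T y w) fp a)))
    where
    at-p : ∀ {w} → Adj T (inj₁ u) w → Adj T (f (inj₁ p)) w
    at-p {w} = subst (λ y → Adj T y w) (sym fp)

    -- A block through p is sent to an edge of K_{k,k}, which has only two ends.
    k≤2 : suc (suc k′) ≤ 2
    k≤2 = let (B , _ , fB) = block-at (at-p (incident-edge-adjacent u zero))
          in subst (_≤ 2) (block-size B) (block-size≤2 B fB)

    two-neighbours : ∀ w → Σ (Fin (suc (suc k′))) (λ j → w ≡ inj₂ (incident-edge u j)) →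
                     w ≡ inj₂ (incident-edge u zero) ⊎ w ≡ inj₂ (incident-edge u (suc zero))
    two-neighbours w (j , refl) with Fin-≤2-cases k≤2 j
    ... | inj₁ refl = inj₁ refl
    ... | inj₂ refl = inj₂ refl

proposition4p12 : (v b r k λ₁ t : ℕ) (I : Incidence v b) →
    k < v → 2 ≤ k → r < b →
    IsSPBIBD I r k λ₁ 0 (k ∸ 1) t →
    IsQuasiSymmetric I 0 1 →
    (r ≡ 2 ⇔ ((IncidenceGraph I ≅ Subdivision (CompleteBipartite k k)) × b ≡ 2 * k))
    × (r ≡ 2 → TwoHomogeneous (IncidenceGraph I) IsBlock)
proposition4p12 zero    _ _ _             _ _ _ ()    _            _ _ _
proposition4p12 (suc _) _ _ 0             _ _ _ _     ()           _ _ _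
proposition4p12 (suc _) _ _ 1             _ _ _ _     (s≤s ())     _ _ _
proposition4p12 (suc v) b r (suc (suc k′)) λ₁ t I _ _ _ S Q =
  mk⇔ (λ r≡2 → Design.≅-subdivision r≡2 , Design.b≡2k r≡2)
      (λ (iso , _) → trans (sym (replication zero)) (FromSubdivision.point-degree I iso block-size zero)) ,
  Design.block-homogeneous
  where
  open IsSPBIBD S using (replication; block-size)
  module Design (r≡2 : r ≡ 2) = TwoRegularDesign I S Q refl r≡2
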